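{- Let $n\geq 4$ be an integer and set $a=f_n^2$, $b=f_{n+1}^2$, $c=f_{n+2}^2$. Let $\kappa=\lfloor c/b\rfloor$ and let $\ell$ be the least non-negative integer with $\ell\, b\equiv c \pmod{a}$ (i.e. $\ell\equiv cb^{ -1}\pmod a$). Then $\kappa=2$ and \[ \ell=\begin{cases} f_nf_{n-3}+1, & \text{if $n$ is even,}\\ 2f_nf_{n-2}+1, & \text{if $n$ is odd.}\end{cases} \]
   Context: The Fibonacci numbers are defined by $f_0=0$, $f_1=1$, $f_k=f_{k-1}+f_{k-2}$ for $k\geq 2$. Here $b$ is invertible modulo $a$ since $\gcd(f_n,f_{n+1})=1$. -}

module Defs where

open import Data.Nat using (ℕ; zero; suc; _+_; _*_; _≤_)
open import Data.Integer using (ℤ; +_; _-_)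
open import Data.Integer.Divisibility using (_∣_)
open import Data.Product using (_×_)

fib : ℕ → ℕ
fib zero = 0
fib (suc zero) = 1
fib (suc (suc k)) = fib (suc k) + fib k

infix 4 _≡_[mod_]
_≡_[mod_] : ℕ → ℕ → ℕ → Set
x ≡ y [mod m ] = (+ m) ∣ ((+ x) - (+ y))

IsLeast : (ℕ → Set) → ℕ → Set
IsLeast P x = P x × (∀ y → P y → x ≤ y)

open import Data.Nat using (NonZero; >-nonZero; _<_; s≤s; z≤n)
open import Data.Nat.Properties using (≤-trans; m≤m+n)

fib-suc-pos : ∀ k → 0 < fib (suc k)
fib-suc-pos zero = s≤s z≤n
fib-suc-pos (suc k) = ≤-trans (fib-suc-pos k) (m≤m+n (fib (suc k)) (fib k))

fibSq-suc-nonZero : ∀ k → NonZero (fib (suc k) * fib (suc k))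
fibSq-suc-nonZero k = >-nonZero (Data.Nat.Properties.*-mono-< {0} {_} {0} (fib-suc-pos k) (fib-suc-pos k))

{-# OPTIONS --safe #-}
-- Write f = f_n and r = f_{n-1}, so that f_{n+1} = f + r and f_{n+2} = 2f + r. Modulo f²,
-- (f x + 1)(f + r)² ≡ r² + f r (2 + x r) and (2f + r)² ≡ r² + 4 f r, hence ℓ = f x + 1
-- solves ℓ f_{n+1}² ≡ f_{n+2}² (mod f²) as soon as x r ≡ 2 (mod f). Cassini's identity gives
-- r² ≡ (-1)ⁿ (mod f), and f_{n-3} = 2r - f, f_{n-2} = f - r, so x = f_{n-3} works for even n
-- and x = 2 f_{n-2} for odd n. Both values are below f, so ℓ < f², and ℓ is the least
-- solution because consecutive Fibonacci numbers are coprime. Finally f_n / f_{n+1} lies in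
-- [1/2, 2/3], so (f_{n+2} / f_{n+1})² lies in [9/4, 25/9] ⊂ [2, 3).
module Submission where

open import Defs
open import Data.Integer as ℤ using (ℤ; +_; _⊖_)
open import Data.Integer.Divisibility.Signed as ℤ using (divides; ∣ᵤ⇒∣; ∣⇒∣ᵤ; ∣m∣n⇒∣m-n)
open import Data.Integer.Properties using (pos-*; i≡j⇒i-j≡0; [+m]-[+n]≡m⊖n; ⊖-≥)
  renaming (+-identityˡ to ℤ-+-identityˡ)
open import Data.Integer.Tactic.RingSolver using ()
  renaming (solve to ℤ-solve; solve-∀ to ℤ-solve-∀)
open import Data.List using (_∷_; [])
open import Data.Nat
  using (ℕ; suc; _+_; _*_; _∸_; _≤_; _<_; _/_; _%_; s≤s; s≤s⁻¹; NonZero; >-nonZero)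
open import Data.Nat.Coprimality using (Coprime; coprime-+; coprime-divisor; 1-coprimeTo)
  renaming (sym to coprime-sym)
open import Data.Nat.DivMod using (m<n*o⇒m/o<n; /-monoˡ-≤; m*n/n≡m)
open import Data.Nat.Divisibility using (_∣_; ∣-trans; >⇒∤)
open import Data.Nat.Properties
  using (≤-antisym; ≤-trans; <⇒≤; ≤-<-trans; ≮⇒≥; m≤m+n; m<m+n; m<n+m; m∸n≤m; m<n⇒0<n∸m;
         +-identityʳ; +-comm; +-mono-≤; +-monoʳ-<; +-monoˡ-<;
         *-comm; *-assoc; *-suc; *-monoʳ-≤; *-monoˡ-≤; *-distribʳ-∸; module ≤-Reasoning)
open import Data.Nat.Tactic.RingSolver using (solve)
open import Data.Product using (_×_; _,_; proj₁; proj₂; map)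
open import Function using (_∘_)
open import Relation.Binary.PropositionalEquality
  using (_≡_; refl; sym; trans; cong; subst; module ≡-Reasoning)

≡-mod-intro : ∀ {m x y} t u → x + m * t ≡ y + m * u → x ≡ y [mod m ]
≡-mod-intro {m} {x} {y} t u eq =
  ∣⇒∣ᵤ {+ m} {+ x ℤ.- + y} (divides (+ u ℤ.- + t) (rearrange (+ x) (+ y) (+ m) (+ t) (+ u) eqℤ))
  where
  open ≡-Reasoning
  eqℤ : + x ℤ.+ + m ℤ.* + t ≡ + y ℤ.+ + m ℤ.* + u
  eqℤ = begin
    + x ℤ.+ + m ℤ.* + t  ≡⟨ cong (λ z → + x ℤ.+ z) (pos-* m t) ⟨
    + (x + m * t)        ≡⟨ cong +_ eq ⟩
    + (y + m * u)        ≡⟨ cong (λ z → + y ℤ.+ z) (pos-* m u) ⟩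
    + y ℤ.+ + m ℤ.* + u  ∎
  rearrange : ∀ (X Y M T U : ℤ) → X ℤ.+ M ℤ.* T ≡ Y ℤ.+ M ℤ.* U → X ℤ.- Y ≡ (U ℤ.- T) ℤ.* M
  rearrange X Y M T U eq = begin
    X ℤ.- Y
      ≡⟨ ℤ-solve (X ∷ Y ∷ M ∷ T ∷ U ∷ []) ⟩
    ((X ℤ.+ M ℤ.* T) ℤ.- (Y ℤ.+ M ℤ.* U)) ℤ.+ (U ℤ.- T) ℤ.* M
      ≡⟨ cong (λ z → z ℤ.+ (U ℤ.- T) ℤ.* M) (i≡j⇒i-j≡0 eq) ⟩
    ℤ.0ℤ ℤ.+ (U ℤ.- T) ℤ.* M
      ≡⟨ ℤ-+-identityˡ _ ⟩
    (U ℤ.- T) ℤ.* M ∎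

≡-mod⇒∣∸ : ∀ {m x y z} → y ≤ x → x ≡ z [mod m ] → y ≡ z [mod m ] → m ∣ x ∸ y
≡-mod⇒∣∸ {m} {x} {y} {z} y≤x x≡z y≡z =
  ∣⇒∣ᵤ (subst (+ m ℤ.∣_) difference
    (∣m∣n⇒∣m-n (∣ᵤ⇒∣ {+ m} {+ x ℤ.- + z} x≡z) (∣ᵤ⇒∣ {+ m} {+ y ℤ.- + z} y≡z)))
  where
  open ≡-Reasoning
  cancel : ∀ (X Y Z : ℤ) → (X ℤ.- Z) ℤ.- (Y ℤ.- Z) ≡ X ℤ.- Y
  cancel = ℤ-solve-∀
  difference : (+ x ℤ.- + z) ℤ.- (+ y ℤ.- + z) ≡ + (x ∸ y)
  difference = begin
    (+ x ℤ.- + z) ℤ.- (+ y ℤ.- + z) ≡⟨ cancel (+ x) (+ y) (+ z) ⟩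
    + x ℤ.- + y                     ≡⟨ [+m]-[+n]≡m⊖n x y ⟩
    x ⊖ y                           ≡⟨ ⊖-≥ y≤x ⟩
    + (x ∸ y)                       ∎

least-solution : ∀ {a b c ℓ} → Coprime a b → ℓ < a → ℓ * b ≡ c [mod a ] →
                 IsLeast (λ y → y * b ≡ c [mod a ]) ℓ
least-solution {a} {b} {c} {ℓ} a⊥b ℓ<a ℓ-solves = ℓ-solves , minimal
  where
  minimal : ∀ y → y * b ≡ c [mod a ] → ℓ ≤ y
  minimal y y-solves = ≮⇒≥ λ y<ℓ →
    let instance _ = >-nonZero (m<n⇒0<n∸m y<ℓ)
        a∣[ℓ∸y]*b = subst (a ∣_) (sym (*-distribʳ-∸ b ℓ y))
                      (≡-mod⇒∣∸ {z = c} (*-monoˡ-≤ b (<⇒≤ y<ℓ)) ℓ-solves y-solves)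
        a∣ℓ∸y = coprime-divisor a⊥b (subst (a ∣_) (*-comm (ℓ ∸ y) b) a∣[ℓ∸y]*b)
    in >⇒∤ (≤-<-trans (m∸n≤m ℓ y) ℓ<a) a∣ℓ∸y

coprime-*ˡ : ∀ {m n o} → Coprime m o → Coprime n o → Coprime (m * n) o
coprime-*ˡ {m} m⊥o n⊥o {d} (d∣m*n , d∣o) = n⊥o (coprime-divisor d⊥m d∣m*n , d∣o)
  where
  d⊥m : Coprime d m
  d⊥m (e∣d , e∣m) = m⊥o (e∣m , ∣-trans e∣d d∣o)

coprime-² : ∀ {m n} → Coprime m n → Coprime (m * m) (n * n)
coprime-² {m} {n} m⊥n = coprime-sym (coprime-*ˡ n⊥m*m n⊥m*m)
  where
  n⊥m*m : Coprime n (m * m)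
  n⊥m*m = coprime-sym (coprime-*ˡ m⊥n m⊥n)

q*n≤m<[1+q]*n⇒m/n≡q : ∀ {m n} q .⦃ _ : NonZero n ⦄ →
                      q * n ≤ m → m < suc q * n → m / n ≡ q
q*n≤m<[1+q]*n⇒m/n≡q {m} {n} q lower upper =
  ≤-antisym (s≤s⁻¹ (m<n*o⇒m/o<n upper)) (subst (_≤ m / n) (m*n/n≡m q n) (/-monoˡ-≤ n lower))

-- The hypothesis says x r ≡ 2 (mod f), written with explicit multiples of f so that the
-- whole computation stays in the semiring ℕ.
f*x+1-solves : ∀ f r x t u → x * r + f * t ≡ 2 + f * u →
  let g = f + r ; h = g + f in (f * x + 1) * (g * g) ≡ h * h [mod f * f ]
f*x+1-solves f r x t u eq =
  let g = f + r ; h = g + f in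
  ≡-mod-intro (3 + r * t) (f * x + 2 * r * x + r * u) (begin
  (f * x + 1) * (g * g) + f * f * (3 + r * t)
    ≡⟨ solve (f ∷ r ∷ x ∷ t ∷ []) ⟩
  f * f * (f * x + 2 * r * x + 4) + 2 * f * r + r * r + f * r * (x * r + f * t)
    ≡⟨ cong (λ z → f * f * (f * x + 2 * r * x + 4) + 2 * f * r + r * r + f * r * z) eq ⟩
  f * f * (f * x + 2 * r * x + 4) + 2 * f * r + r * r + f * r * (2 + f * u)
    ≡⟨ solve (f ∷ r ∷ x ∷ u ∷ []) ⟩
  h * h + f * f * (f * x + 2 * r * x + r * u) ∎)
  where open ≡-Reasoning

least-solution-f*x+1 : ∀ {f r x} t u → Coprime f (f + r) → 1 < f → x < f →
  x * r + f * t ≡ 2 + f * u →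
  let g = f + r ; h = g + f in IsLeast (λ ℓ → ℓ * (g * g) ≡ h * h [mod f * f ]) (f * x + 1)
least-solution-f*x+1 {f} {r} {x} t u f⊥g 1<f x<f eq =
  least-solution {c = (f + r + f) * (f + r + f)} (coprime-² f⊥g) f*x+1<f*f
    (f*x+1-solves f r x t u eq)
  where
  open ≤-Reasoning
  f*x+1<f*f : f * x + 1 < f * f
  f*x+1<f*f = begin-strict
    f * x + 1  <⟨ +-monoʳ-< (f * x) 1<f ⟩
    f * x + f  ≡⟨ +-comm (f * x) f ⟩
    f + f * x  ≡⟨ *-suc f x ⟨
    f * suc x  ≤⟨ *-monoʳ-≤ f x<f ⟩
    f * f      ∎

fib-coprime : ∀ k → Coprime (fib k) (fib (suc k))
fib-coprime 0       = coprime-sym (1-coprimeTo 0)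
fib-coprime (suc k) = coprime-sym (coprime-+ (fib-coprime k))

cassini-step : ∀ e e′ x y → e + x * x ≡ e′ + (x + y) * y →
               e′ + (x + y) * (x + y) ≡ e + ((x + y) + x) * x
cassini-step e e′ x y eq = begin
  e′ + (x + y) * (x + y)            ≡⟨ solve (e′ ∷ x ∷ y ∷ []) ⟩
  (e′ + (x + y) * y) + (x + y) * x  ≡⟨ cong (_+ (x + y) * x) eq ⟨
  (e + x * x) + (x + y) * x         ≡⟨ solve (e ∷ x ∷ y ∷ []) ⟩
  e + ((x + y) + x) * x             ∎
  where open ≡-Reasoning

cassini : ∀ m → (m % 2 ≡ 0 → fib (1 + m) * fib (1 + m) ≡ 1 + fib (2 + m) * fib m)
              × (m % 2 ≡ 1 → 1 + fib (1 + m) * fib (1 + m) ≡ fib (2 + m) * fib m)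
cassini 0             = (λ _ → refl) , (λ ())
cassini 1             = (λ ()) , (λ _ → refl)
cassini (suc (suc m)) = map (twice 0 1 ∘_) (twice 1 0 ∘_) (cassini m)
  where
  twice : ∀ e e′ → e + fib (1 + m) * fib (1 + m) ≡ e′ + fib (2 + m) * fib m →
          e + fib (3 + m) * fib (3 + m) ≡ e′ + fib (4 + m) * fib (2 + m)
  twice e e′ = cassini-step e′ e (fib (2 + m)) (fib (1 + m))
             ∘ cassini-step e e′ (fib (1 + m)) (fib m)

p*r+f*r≡2+f*2q : ∀ p q → let r = q + p ; f = r + q in
                 r * r ≡ 1 + f * q → p * r + f * r ≡ 2 + f * (2 * q)
p*r+f*r≡2+f*2q p q cassini-even =
  let r = q + p ; f = r + q in begin
  p * r + f * r    ≡⟨ solve (p ∷ q ∷ []) ⟩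
  2 * (r * r)      ≡⟨ cong (2 *_) cassini-even ⟩
  2 * (1 + f * q)  ≡⟨ solve (p ∷ q ∷ []) ⟩
  2 + f * (2 * q)  ∎
  where open ≡-Reasoning

2q*r+f*2q≡2+f*2r : ∀ p q → let r = q + p ; f = r + q in
                   1 + r * r ≡ f * q → 2 * q * r + f * (2 * q) ≡ 2 + f * (2 * r)
2q*r+f*2q≡2+f*2r p q cassini-odd =
  let r = q + p ; f = r + q in begin
  2 * q * r + f * (2 * q)    ≡⟨ solve (p ∷ q ∷ []) ⟩
  2 * q * r + 2 * (f * q)    ≡⟨ cong (λ z → 2 * q * r + 2 * z) cassini-odd ⟨
  2 * q * r + 2 * (1 + r * r) ≡⟨ solve (p ∷ q ∷ []) ⟩
  2 + f * (2 * r)            ∎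
  where open ≡-Reasoning

-- With g = 3q + 2p and h = 5q + 3p, both 3g² - h² and h² - 2g² have nonnegative coefficients.
h²/g²≡2 : ∀ p q → 0 < q → let r = q + p ; f = r + q ; g = f + r ; h = g + f in
          .⦃ _ : NonZero (g * g) ⦄ → h * h / (g * g) ≡ 2
h²/g²≡2 p q@(suc q′) _ =
  let r = q + p ; f = r + q ; g = f + r ; h = g + f in
  q*n≤m<[1+q]*n⇒m/n≡q 2
    (begin
      2 * (g * g)                                    ≤⟨ m≤m+n _ _ ⟩
      2 * (g * g) + (7 * q * q + 6 * p * q + p * p)  ≡⟨ solve (p ∷ q′ ∷ []) ⟩
      h * h                                          ∎)
    (begin
      suc (h * h)
        ≤⟨ m≤m+n _ _ ⟩
      suc (h * h) + (1 + 4 * q′ + 2 * q′ * q′ + 6 * p * q + 3 * p * p)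
        ≡⟨ solve (p ∷ q′ ∷ []) ⟩
      3 * (g * g)
        ∎)
  where open ≤-Reasoning

lemma4p12 : (n : ℕ) → 4 ≤ n →
    _/_ (fib (suc (suc n)) * fib (suc (suc n))) (fib (suc n) * fib (suc n)) ⦃ fibSq-suc-nonZero n ⦄ ≡ 2 ×
    (n % 2 ≡ 0 → IsLeast (λ ℓ → ℓ * (fib (suc n) * fib (suc n)) ≡ fib (suc (suc n)) * fib (suc (suc n)) [mod fib n * fib n ]) (fib n * fib (n ∸ 3) + 1)) ×
    (n % 2 ≡ 1 → IsLeast (λ ℓ → ℓ * (fib (suc n) * fib (suc n)) ≡ fib (suc (suc n)) * fib (suc (suc n)) [mod fib n * fib n ]) (2 * fib n * fib (n ∸ 2) + 1))
lemma4p12 (suc (suc (suc (suc k)))) (s≤s (s≤s (s≤s (s≤s _)))) =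
  h²/g²≡2 p q q>0 ⦃ fibSq-suc-nonZero (4 + k) ⦄ ,
  (λ n-even → least-solution-f*x+1 r (2 * q) f⊥g 1<f p<f
                (p*r+f*r≡2+f*2q p q (proj₁ (cassini (2 + k)) n-even))) ,
  (λ n-odd → subst (IsLeast _) (cong (_+ 1) f*[2*q]≡2*f*q)
               (least-solution-f*x+1 (2 * q) (2 * r) f⊥g 1<f 2*q<f
                 (2q*r+f*2q≡2+f*2r p q (proj₂ (cassini (2 + k)) n-odd))))
  where
  open ≤-Reasoning
  p q r f : ℕ
  p = fib (1 + k)
  q = fib (2 + k)
  r = fib (3 + k)
  f = fib (4 + k)
  p>0 : 0 < p
  p>0 = fib-suc-pos k
  q>0 : 0 < q
  q>0 = fib-suc-pos (1 + k)
  f⊥g : Coprime f (f + r)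
  f⊥g = fib-coprime (4 + k)
  1<f : 1 < f
  1<f = +-mono-≤ (fib-suc-pos (2 + k)) q>0
  p<f : p < f
  p<f = ≤-trans (m<n+m p q>0) (m≤m+n r q)
  2*q<f : 2 * q < f
  2*q<f = begin-strict
    2 * q  ≡⟨ cong (λ z → q + z) (+-identityʳ q) ⟩
    q + q  <⟨ +-monoˡ-< q (m<m+n q p>0) ⟩
    r + q  ∎
  f*[2*q]≡2*f*q : f * (2 * q) ≡ 2 * f * q
  f*[2*q]≡2*f*q = trans (sym (*-assoc f 2 q)) (cong (_* q) (*-comm f 2))
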